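{- Let $A,B:\mathsf{Type}$ and let $a_0:A$ be isolated. Define $\mathrm{graft}_{a_0}:((A\setminus a_0\to B)\times B)\to(A\to B)$ by $\mathrm{graft}_{a_0}(f,b_0)(a):=f(a,h)$ if $h:\neg(a_0=a)$ and $:=b_0$ otherwise (deciding $a_0=a$). Then (1) $\mathrm{graft}_{a_0}(f,b_0)(a_0)=b_0$ and $\mathrm{graft}_{a_0}(f,b_0)(a)=f(a,h)$ for all $a:A$ and $h:\neg(a_0=a)$; and (2) $\mathrm{graft}_{a_0}$ is an equivalence of types $((A\setminus a_0\to B)\times B)\simeq(A\to B)$.
   Context: Work in Homotopy Type Theory with a univalent universe and function extensionality. A point $a_0:A$ is isolated if $a_0=b$ is decidable for all $b:A$. $A\setminus a_0:=\sum_{a:A}\neg(a_0=a)$. -}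

module Defs where

open import Level using (Level; _⊔_; Setω)
open import Data.Product using (Σ; _×_; _,_; proj₁; proj₂)
open import Relation.Nullary using (¬_; Dec; yes; no)
open import Relation.Binary.PropositionalEquality using (_≡_)
open import Axiom.Extensionality.Propositional using (Extensionality)

private
  variable
    a b : Level

isIsolated : {A : Set a} → A → Set a
isIsolated {A = A} a₀ = (x : A) → Dec (a₀ ≡ x)

_∖_ : (A : Set a) → A → Set a
A ∖ a₀ = Σ A (λ x → ¬ (a₀ ≡ x))

FunExt : Setω
FunExt = ∀ {ℓ ℓ′} → Extensionality ℓ ℓ′

isEquiv : {A : Set a} {B : Set b} → (A → B) → Set (a ⊔ b)
isEquiv {A = A} {B = B} f =
  (Σ (B → A) λ g → (y : B) → f (g y) ≡ y) ×
  (Σ (B → A) λ h → (x : A) → h (f x) ≡ x)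

graft : {A : Set a} {B : Set b} (a₀ : A) → isIsolated a₀ →
        ((A ∖ a₀ → B) × B) → A → B
graft a₀ iso (f , b₀) x with iso x
... | yes _ = b₀
... | no h  = f (x , h)

-- Deciding a₀ ≡ x splits A into the point a₀ and its complement A ∖ a₀, so a
-- map out of A is the same as a map out of A ∖ a₀ together with a value at a₀;
-- the inverse of graft restricts k : A → B to both pieces. Round-tripping
-- through A ∖ a₀ only needs that any two proofs of ¬ (a₀ ≡ x) are equal,
-- which holds by function extensionality since ⊥ has no elements.
module Submission where

open import Defs
open import Level using (Level)
open import Data.Product using (Σ; _×_; _,_)
open import Data.Empty using (⊥-elim)
open import Relation.Nullary using (¬_; yes; no)
open import Relation.Binary.PropositionalEquality using (_≡_; refl; cong; cong₂)

¬-irrelevant : FunExt → ∀ {ℓ} {P : Set ℓ} (h h′ : ¬ P) → h ≡ h′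
¬-irrelevant fe h h′ = fe (λ p → ⊥-elim (h p))

module _ {ℓa ℓb : Level} {A : Set ℓa} {B : Set ℓb}
         (a₀ : A) (iso : isIsolated a₀) where

  graft-at-point : (f : A ∖ a₀ → B) (b₀ : B) → graft a₀ iso (f , b₀) a₀ ≡ b₀
  graft-at-point f b₀ with iso a₀
  ... | yes _ = refl
  ... | no h  = ⊥-elim (h refl)

  graft-off-point : FunExt → (f : A ∖ a₀ → B) (b₀ : B) (x : A) (h : ¬ (a₀ ≡ x)) →
                    graft a₀ iso (f , b₀) x ≡ f (x , h)
  graft-off-point fe f b₀ x h with iso x
  ... | yes p = ⊥-elim (h p)
  ... | no h′ = cong (λ h″ → f (x , h″)) (¬-irrelevant fe h′ h)

  restrict : (A → B) → (A ∖ a₀ → B) × B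
  restrict k = (λ (x , _) → k x) , k a₀

  graft-restrict : (k : A → B) (x : A) → graft a₀ iso (restrict k) x ≡ k x
  graft-restrict k x with iso x
  ... | yes p = cong k p
  ... | no _  = refl

  restrict-graft : FunExt → (fb : (A ∖ a₀ → B) × B) → restrict (graft a₀ iso fb) ≡ fb
  restrict-graft fe (f , b₀) =
    cong₂ _,_ (fe (λ (x , h) → graft-off-point fe f b₀ x h)) (graft-at-point f b₀)

  graft-isEquiv : FunExt → isEquiv (graft {A = A} {B = B} a₀ iso)
  graft-isEquiv fe = (restrict , λ k → fe (graft-restrict k)) , (restrict , restrict-graft fe)

proposition2p23 : FunExt → {ℓa ℓb : Level} (A : Set ℓa) (B : Set ℓb)
    (a₀ : A) (iso : isIsolated a₀) →
    (((f : A ∖ a₀ → B) (b₀ : B) → graft a₀ iso (f , b₀) a₀ ≡ b₀) ×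
     ((f : A ∖ a₀ → B) (b₀ : B) (x : A) (h : ¬ (a₀ ≡ x)) →
       graft a₀ iso (f , b₀) x ≡ f (x , h))) ×
    isEquiv (graft {A = A} {B = B} a₀ iso)
proposition2p23 fe A B a₀ iso =
  (graft-at-point a₀ iso , graft-off-point a₀ iso fe) , graft-isEquiv a₀ iso fe
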